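{- For all $n\geq 3$, the number of desarrangements of length $n$ avoiding both $312$ and $321$ is $d_n(312,321)=2^{n-3}$.
   Context: Permutations are in one-line notation. An index $i\in[n-1]$ is a descent of $\pi\in\mathfrak{S}_n$ if $\pi_i>\pi_{i+1}$; $i\in[n]$ is an ascent if it is not a descent (so $n$ is always an ascent). A desarrangement is a permutation whose first ascent is even. $d_n(\Pi)$ is the number of desarrangements in $\mathfrak{S}_n$ avoiding every pattern in $\Pi$ ($\pi$ avoids $\sigma$ if no subsequence of $\pi$ has the same relative order as $\sigma$). -}

module Defs where

open import Data.Nat as ℕ using (ℕ; zero; suc; _+_)
open import Data.Nat.Divisibility using (_∣_; _∣?_)
open import Data.Fin as F using (Fin; toℕ)
open import Data.Fin.Properties using (_≟_; _<?_; any?; all?)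
open import Data.Vec using (Vec; []; _∷_; lookup)
open import Data.List using (List; []; _∷_; map; concatMap; filter; length)
open import Data.Product using (Σ; ∃; _×_; _,_)
open import Data.Sum using (_⊎_)
open import Relation.Nullary using (Dec; ¬_; yes; no)
open import Relation.Nullary.Decidable using (_×-dec_; _⊎-dec_; ¬?; _→-dec_)
open import Relation.Binary.PropositionalEquality using (_≡_)

allFins : ∀ m → List (Fin m)
allFins zero = []
allFins (suc m) = F.zero ∷ map F.suc (allFins m)

allVecs : ∀ {m} n → List (Vec (Fin m) n)
allVecs zero = [] ∷ []
allVecs {m} (suc n) = concatMap (λ x → map (x ∷_) (allVecs n)) (allFins m)

-- A permutation of length n in one-line notation (values 0..n-1 instead of
-- 1..n, which does not affect relative order): a vector of length n over
-- Fin n whose entries are pairwise distinct.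
IsPerm : ∀ {n} → Vec (Fin n) n → Set
IsPerm {n} π = ∀ (i j : Fin n) → lookup π i ≡ lookup π j → i ≡ j

isPerm? : ∀ {n} (π : Vec (Fin n) n) → Dec (IsPerm π)
isPerm? π = all? λ i → all? λ j → (lookup π i ≟ lookup π j) →-dec (i ≟ j)

-- Positions are 0-based: position p : Fin n is the index toℕ p + 1 of the paper.
-- The index toℕ p + 1 is an ascent iff it equals n, or it is < n and
-- π_{p} < π_{p+1} (i.e. it is not a descent).
Ascent : ∀ {n} → Vec (Fin n) n → Fin n → Set
Ascent {n} π p =
  (toℕ p + 1 ≡ n) ⊎ (Σ (Fin n) λ q → (toℕ q ≡ toℕ p + 1) × (lookup π p F.< lookup π q))

ascent? : ∀ {n} (π : Vec (Fin n) n) (p : Fin n) → Dec (Ascent π p)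
ascent? {n} π p =
  (toℕ p + 1 ℕ.≟ n) ⊎-dec any? (λ q → (toℕ q ℕ.≟ toℕ p + 1) ×-dec (lookup π p <? lookup π q))

IsDesarrangement : ∀ {n} → Vec (Fin n) n → Set
IsDesarrangement {n} π =
  Σ (Fin n) λ p → Ascent π p × (2 ∣ toℕ p + 1) × (∀ (q : Fin n) → q F.< p → ¬ Ascent π q)

isDesarrangement? : ∀ {n} (π : Vec (Fin n) n) → Dec (IsDesarrangement π)
isDesarrangement? π =
  any? λ p → ascent? π p ×-dec ((2 ∣? (toℕ p + 1)) ×-dec
    all? (λ q → (q <? p) →-dec ¬? (ascent? π q)))

SameOrder₃ : ∀ {n} → Vec ℕ 3 → Vec (Fin n) 3 → Set
SameOrder₃ σ τ = ∀ (a b : Fin 3) → ((lookup σ a ℕ.< lookup σ b → lookup τ a F.< lookup τ b)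
                                × (lookup τ a F.< lookup τ b → lookup σ a ℕ.< lookup σ b))

sameOrder₃? : ∀ {n} (σ : Vec ℕ 3) (τ : Vec (Fin n) 3) → Dec (SameOrder₃ σ τ)
sameOrder₃? σ τ = all? λ a → all? λ b → ((lookup σ a ℕ.<? lookup σ b) →-dec (lookup τ a <? lookup τ b))
    ×-dec ((lookup τ a <? lookup τ b) →-dec (lookup σ a ℕ.<? lookup σ b))

Contains₃ : ∀ {n} → Vec ℕ 3 → Vec (Fin n) n → Set
Contains₃ {n} σ π = Σ (Fin n) λ i → Σ (Fin n) λ j → Σ (Fin n) λ k →
  (i F.< j) × (j F.< k) × SameOrder₃ σ (lookup π i ∷ lookup π j ∷ lookup π k ∷ [])

contains₃? : ∀ {n} (σ : Vec ℕ 3) (π : Vec (Fin n) n) → Dec (Contains₃ σ π)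
contains₃? σ π = any? λ i → any? λ j → any? λ k →
  (i <? j) ×-dec ((j <? k) ×-dec sameOrder₃? σ (lookup π i ∷ lookup π j ∷ lookup π k ∷ []))

Avoids₃ : ∀ {n} → Vec ℕ 3 → Vec (Fin n) n → Set
Avoids₃ σ π = ¬ Contains₃ σ π

Counted : ∀ {n} → Vec (Fin n) n → Set
Counted π = IsPerm π × IsDesarrangement π
  × Avoids₃ (3 ∷ 1 ∷ 2 ∷ []) π × Avoids₃ (3 ∷ 2 ∷ 1 ∷ []) π

counted? : ∀ {n} (π : Vec (Fin n) n) → Dec (Counted π)
counted? π = isPerm? π ×-dec (isDesarrangement? π
  ×-dec (¬? (contains₃? (3 ∷ 1 ∷ 2 ∷ []) π) ×-dec ¬? (contains₃? (3 ∷ 2 ∷ 1 ∷ []) π)))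

d-312-321 : ℕ → ℕ
d-312-321 n = length (filter (counted? {n}) (allVecs n))

module Submission where

-- A permutation avoids 312 and 321 iff no entry is followed by two smaller entries.
-- Read such a permutation of {0, …, N − 1} from the left: the values still to be
-- placed always form a set {g} ∪ (t, N) with g ≤ t, and the next entry must be g or
-- t + 1, because any larger available entry has both of them below it.  Placing g
-- leaves (t, N) = {t + 1} ∪ (t + 1, N) and placing t + 1 leaves {g} ∪ (t + 1, N), so
-- a set of this shape with k + 1 elements has 2^k arrangements.  A desarrangement
-- starts with a descent, which here forces the first two entries to be 1 0; the
-- first ascent is then at index 2, and what remains is any arrangement of
-- {2} ∪ (2, N), giving 2^(N − 3).

open import Defs
open import Data.Bool using (T)
open import Data.Fin as F using (Fin; toℕ; fromℕ<; punchOut)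
open import Data.Fin.Patterns using (0F; 1F; 2F)
open import Data.Fin.Properties
  using (_≟_; any?; all?; <⇒≢; <-cmp; toℕ-injective; toℕ-fromℕ<; toℕ<n; suc-injective; ¬Fin0;
         injective⇒≤; punchOut-injective)
open import Data.List as List using (List; []; _∷_; [_]; map; concatMap; filter; length)
open import Data.List.Properties
  using (filter-++; length-++; filter-≐; filter-none; filter-accept; map-∘; map-cong)
open import Data.List.Relation.Unary.All using (universal)
open import Data.Nat as ℕ using (ℕ; zero; suc; _+_; _∸_; _^_; _≤_; z≤n; s≤s; z<s; s<s)
open import Data.Nat.Divisibility using (∣1⇒≡1; ∣-refl)
open import Data.Nat.ListAction using (sum)
open import Data.Nat.Properties as ℕ using (+-identityʳ; +-comm; +-suc)
open import Data.Product using (∃; ∃₂; _×_; _,_; proj₁; proj₂; map₁)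
open import Data.Sum using (_⊎_; inj₁; inj₂; [_,_]′)
open import Data.Vec using (Vec; []; _∷_; lookup)
open import Function using (_∘_; Injective; _⇔_; mk⇔; Equivalence)
import Function.Properties.Equivalence as ⇔
open import Level using (0ℓ)
open import Relation.Binary using (tri<; tri≈; tri>)
open import Relation.Binary.PropositionalEquality
  using (_≡_; _≢_; refl; sym; trans; cong; cong₂; subst; subst₂; module ≡-Reasoning)
open import Relation.Nullary using (Dec; ¬_; yes; no; contradiction)
open import Relation.Nullary.Decidable using (_×-dec_; _⊎-dec_; _→-dec_; ¬?; toWitness)
open import Relation.Unary using (Pred; Decidable; _∈_; _≐_; _⊆_; _∖_; ｛_｝; Empty)
open import Relation.Unary.Properties using (≐-sym; _∩?_; ∁?)

count : ∀ {A : Set} {P : Pred A 0ℓ} → Decidable P → List A → ℕ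
count P? xs = length (filter P? xs)

module _ {A : Set} {P : Pred A 0ℓ} (P? : Decidable P) where

  count-≐ : ∀ {Q : Pred A 0ℓ} (Q? : Decidable Q) → P ≐ Q → ∀ xs → count P? xs ≡ count Q? xs
  count-≐ Q? P≐Q xs = cong length (filter-≐ P? Q? P≐Q xs)

  count-none : (∀ x → ¬ P x) → ∀ xs → count P? xs ≡ 0
  count-none ¬P xs = cong length (filter-none P? (universal ¬P xs))

  count-singleton : ∀ {x} → P x → count P? [ x ] ≡ 1
  count-singleton Px = cong length (filter-accept P? Px)

  count-map : ∀ {B : Set} (f : B → A) xs → count P? (map f xs) ≡ count (P? ∘ f) xs
  count-map f []       = refl
  count-map f (x ∷ xs) with P? (f x)
  ... | yes _ = cong suc (count-map f xs)
  ... | no  _ = count-map f xs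

  count-concatMap : ∀ {B : Set} (f : B → List A) xs →
                    count P? (concatMap f xs) ≡ sum (map (count P? ∘ f) xs)
  count-concatMap f []       = refl
  count-concatMap f (x ∷ xs) = begin
    length (filter P? (f x List.++ concatMap f xs))
      ≡⟨ cong length (filter-++ P? (f x) (concatMap f xs)) ⟩
    length (filter P? (f x) List.++ filter P? (concatMap f xs))
      ≡⟨ length-++ (filter P? (f x)) ⟩
    count P? (f x) + count P? (concatMap f xs)
      ≡⟨ cong (count P? (f x) +_) (count-concatMap f xs) ⟩
    count P? (f x) + sum (map (count P? ∘ f) xs) ∎
    where open ≡-Reasoning

sum-allFins-suc : ∀ {n} (f : Fin (suc n) → ℕ) →
                  sum (map f (allFins (suc n))) ≡ f F.zero + sum (map (f ∘ F.suc) (allFins n))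
sum-allFins-suc {n} f = cong (λ xs → f F.zero + sum xs) (sym (map-∘ (allFins n)))

sum-allFins-zero : ∀ {n} (f : Fin n → ℕ) → (∀ x → f x ≡ 0) → sum (map f (allFins n)) ≡ 0
sum-allFins-zero {zero}  f f≡0 = refl
sum-allFins-zero {suc n} f f≡0 = trans (sum-allFins-suc f)
  (cong₂ _+_ (f≡0 F.zero) (sum-allFins-zero (f ∘ F.suc) (f≡0 ∘ F.suc)))

sum-allFins-point : ∀ {n} (f : Fin n → ℕ) i → (∀ x → x ≢ i → f x ≡ 0) →
                    sum (map f (allFins n)) ≡ f i
sum-allFins-point {suc n} f F.zero f≡0 = begin
  sum (map f (allFins (suc n)))
    ≡⟨ sum-allFins-suc f ⟩
  f F.zero + sum (map (f ∘ F.suc) (allFins n))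
    ≡⟨ cong (f F.zero +_) (sum-allFins-zero (f ∘ F.suc) (λ x → f≡0 (F.suc x) λ ())) ⟩
  f F.zero + 0
    ≡⟨ +-identityʳ (f F.zero) ⟩
  f F.zero ∎
  where open ≡-Reasoning
sum-allFins-point {suc n} f (F.suc i) f≡0 = trans (sum-allFins-suc f)
  (cong₂ _+_ (f≡0 F.zero λ ())
             (sum-allFins-point (f ∘ F.suc) i λ x x≢i → f≡0 (F.suc x) (x≢i ∘ suc-injective)))

sum-allFins-two-points : ∀ {n} (f : Fin n → ℕ) i j → i ≢ j → (∀ x → x ≢ i → x ≢ j → f x ≡ 0) →
                         sum (map f (allFins n)) ≡ f i + f j
sum-allFins-two-points f F.zero F.zero 0≢0 _ = contradiction refl 0≢0
sum-allFins-two-points {suc n} f F.zero (F.suc j) _ f≡0 = trans (sum-allFins-suc f)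
  (cong (f F.zero +_)
        (sum-allFins-point (f ∘ F.suc) j λ x x≢j → f≡0 (F.suc x) (λ ()) (x≢j ∘ suc-injective)))
sum-allFins-two-points f (F.suc i) F.zero i≢j f≡0 = begin
  sum (map f (allFins _))
    ≡⟨ sum-allFins-two-points f F.zero (F.suc i) (i≢j ∘ sym) (λ x x≢0 x≢i → f≡0 x x≢i x≢0) ⟩
  f F.zero + f (F.suc i)
    ≡⟨ +-comm (f F.zero) (f (F.suc i)) ⟩
  f (F.suc i) + f F.zero ∎
  where open ≡-Reasoning
sum-allFins-two-points {suc n} f (F.suc i) (F.suc j) i≢j f≡0 = trans (sum-allFins-suc f)
  (cong₂ _+_ (f≡0 F.zero (λ ()) (λ ()))
             (sum-allFins-two-points (f ∘ F.suc) i j (i≢j ∘ cong F.suc) λ x x≢i x≢j →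
                f≡0 (F.suc x) (x≢i ∘ suc-injective) (x≢j ∘ suc-injective)))

module _ {N k : ℕ} {P : Pred (Vec (Fin N) (suc k)) 0ℓ} (P? : Decidable P) where

  countAfter : Fin N → ℕ
  countAfter x = count (λ w → P? (x ∷ w)) (allVecs k)

  count-allVecs-suc : count P? (allVecs (suc k)) ≡ sum (map countAfter (allFins N))
  count-allVecs-suc = begin
    count P? (allVecs (suc k))
      ≡⟨ count-concatMap P? (λ x → map (x ∷_) (allVecs k)) (allFins N) ⟩
    sum (map (λ x → count P? (map (x ∷_) (allVecs k))) (allFins N))
      ≡⟨ cong sum (map-cong (λ x → count-map P? (x ∷_) (allVecs k)) (allFins N)) ⟩
    sum (map countAfter (allFins N)) ∎
    where open ≡-Reasoning

  countAfter-≐ : ∀ {Q} (Q? : Decidable Q) x → (λ w → P (x ∷ w)) ≐ Q →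
                 countAfter x ≡ count Q? (allVecs k)
  countAfter-≐ Q? x P[x∷]≐Q = count-≐ (λ w → P? (x ∷ w)) Q? P[x∷]≐Q (allVecs k)

  count-allVecs-point : ∀ i → (∀ x w → x ≢ i → ¬ P (x ∷ w)) →
                        count P? (allVecs (suc k)) ≡ countAfter i
  count-allVecs-point i ¬P = trans count-allVecs-suc
    (sum-allFins-point countAfter i (λ x x≢i → count-none _ (λ w → ¬P x w x≢i) (allVecs k)))

  count-allVecs-two-points : ∀ i j → i ≢ j → (∀ x w → x ≢ i → x ≢ j → ¬ P (x ∷ w)) →
                             count P? (allVecs (suc k)) ≡ countAfter i + countAfter j
  count-allVecs-two-points i j i≢j ¬P = trans count-allVecs-suc
    (sum-allFins-two-points countAfter i j i≢j
      (λ x x≢i x≢j → count-none _ (λ w → ¬P x w x≢i x≢j) (allVecs k)))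

module _ {N : ℕ} where

  fromℕ<-≢ : ∀ {m n} (m<N : m ℕ.< N) (n<N : n ℕ.< N) → m ≢ n → fromℕ< m<N ≢ fromℕ< n<N
  fromℕ<-≢ m<N n<N m≢n e = m≢n (trans (sym (toℕ-fromℕ< m<N)) (trans (cong toℕ e) (toℕ-fromℕ< n<N)))

  ≢fromℕ<⇒toℕ≢ : ∀ {v} {x : Fin N} (v<N : v ℕ.< N) → x ≢ fromℕ< v<N → toℕ x ≢ v
  ≢fromℕ<⇒toℕ≢ v<N x≢v x≡v = x≢v (toℕ-injective (trans x≡v (sym (toℕ-fromℕ< v<N))))

  TwoBelow : Pred (Fin N) 0ℓ → Fin N → Set
  TwoBelow S x = ∃₂ λ a b → a ∈ S × b ∈ S × a F.< x × b F.< x × a ≢ b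

  twoBelow? : ∀ {S} → Decidable S → Decidable (TwoBelow S)
  twoBelow? S? x = any? λ a → any? λ b →
    S? a ×-dec S? b ×-dec a F.<? x ×-dec b F.<? x ×-dec ¬? (a ≟ b)

  -- w lists the elements of S once each, and no entry of w is followed by two smaller ones.
  Arranges : ∀ {k} → Pred (Fin N) 0ℓ → Vec (Fin N) k → Set
  Arranges S []      = Empty S
  Arranges S (x ∷ w) = x ∈ S × ¬ TwoBelow S x × Arranges (S ∖ ｛ x ｝) w

  arranges? : ∀ {k S} → Decidable S → Decidable (Arranges {k} S)
  arranges? S? []      = all? (∁? S?)
  arranges? S? (x ∷ w) = S? x ×-dec ¬? (twoBelow? S? x) ×-dec arranges? (S? ∩? ∁? (x ≟_)) w

  arranges-≐ : ∀ {k S T} → S ≐ T → (w : Vec (Fin N) k) → Arranges S w → Arranges T w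
  arranges-≐ (_ , T⊆S) []      S-empty v v∈T = S-empty v (T⊆S v∈T)
  arranges-≐ (S⊆T , T⊆S) (x ∷ w) (x∈S , ¬twoBelow , rest) =
    S⊆T x∈S ,
    (λ (a , b , a∈T , b∈T , below) → ¬twoBelow (a , b , T⊆S a∈T , T⊆S b∈T , below)) ,
    arranges-≐ (map₁ S⊆T , map₁ T⊆S) w rest

  arranges-∷-≐ : ∀ {k S T x} → x ∈ S → ¬ TwoBelow S x → S ∖ ｛ x ｝ ≐ T →
                 (λ w → Arranges S (x ∷ w)) ≐ Arranges {k} T
  arranges-∷-≐ x∈S ¬twoBelow S-x≐T =
    (λ {w} (_ , _ , rest) → arranges-≐ S-x≐T w rest) ,
    (λ {w} rest → x∈S , ¬twoBelow , arranges-≐ (≐-sym S-x≐T) w rest)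

  TwoSmallerAfter : ∀ {k} → Vec (Fin N) k → Set
  TwoSmallerAfter w = ∃ λ i → ∃₂ λ j l → i F.< j × j F.< l ×
    lookup w j F.< lookup w i × lookup w l F.< lookup w i × lookup w j ≢ lookup w l

  arranges-∈ : ∀ {k S} (w : Vec (Fin N) k) → Arranges S w → ∀ i → lookup w i ∈ S
  arranges-∈ (x ∷ w) (x∈S , _ , _)    F.zero    = x∈S
  arranges-∈ (x ∷ w) (_   , _ , rest) (F.suc i) = proj₁ (arranges-∈ w rest i)

  arranges-injective : ∀ {k S} (w : Vec (Fin N) k) → Arranges S w → Injective _≡_ _≡_ (lookup w)
  arranges-injective (x ∷ w) _ {F.zero} {F.zero} _ = refl
  arranges-injective (x ∷ w) (_ , _ , rest) {F.zero} {F.suc j} x≡wⱼ =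
    contradiction x≡wⱼ (proj₂ (arranges-∈ w rest j))
  arranges-injective (x ∷ w) (_ , _ , rest) {F.suc i} {F.zero} wᵢ≡x =
    contradiction (sym wᵢ≡x) (proj₂ (arranges-∈ w rest i))
  arranges-injective (x ∷ w) (_ , _ , rest) {F.suc i} {F.suc j} wᵢ≡wⱼ =
    cong F.suc (arranges-injective w rest wᵢ≡wⱼ)

  arranges⇒¬twoSmallerAfter : ∀ {k S} (w : Vec (Fin N) k) → Arranges S w → ¬ TwoSmallerAfter w
  arranges⇒¬twoSmallerAfter (x ∷ w) (_ , ¬twoBelow , rest) (F.zero , F.suc j , F.suc l , _ , _ , below) =
    ¬twoBelow (lookup w j , lookup w l , proj₁ (arranges-∈ w rest j) , proj₁ (arranges-∈ w rest l) , below)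
  arranges⇒¬twoSmallerAfter (x ∷ w) (_ , _ , rest)
                            (F.suc i , F.suc j , F.suc l , s<s i<j , s<s j<l , smaller) =
    arranges⇒¬twoSmallerAfter w rest (i , j , l , i<j , j<l , smaller)

  arranges-intro : ∀ {k S} (w : Vec (Fin N) k) → Injective _≡_ _≡_ (lookup w) →
                   (∀ i → lookup w i ∈ S) → (∀ {v} → v ∈ S → ∃ λ i → lookup w i ≡ v) →
                   ¬ TwoSmallerAfter w → Arranges S w
  arranges-intro []      _   _    onto _ v v∈S = ¬Fin0 (proj₁ (onto v∈S))
  arranges-intro {S = S} (x ∷ w) inj into onto ¬twoSmallerAfter =
    into F.zero , ¬twoBelow ,
    arranges-intro w (suc-injective ∘ inj) into′ onto′ (¬twoSmallerAfter ∘ shift)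
    where
    shift : TwoSmallerAfter w → TwoSmallerAfter (x ∷ w)
    shift (i , j , l , i<j , j<l , smaller) = F.suc i , F.suc j , F.suc l , s<s i<j , s<s j<l , smaller
    into′ : ∀ i → lookup w i ∈ S ∖ ｛ x ｝
    into′ i = into (F.suc i) , λ x≡wᵢ → contradiction (inj {F.zero} {F.suc i} x≡wᵢ) λ ()
    onto′ : ∀ {v} → v ∈ S ∖ ｛ x ｝ → ∃ λ i → lookup w i ≡ v
    onto′ (v∈S , x≢v) with onto v∈S
    ... | F.zero  , x≡v = contradiction x≡v x≢v
    ... | F.suc i , wᵢ≡v = i , wᵢ≡v
    ¬twoBelow : ¬ TwoBelow S x
    ¬twoBelow (a , b , a∈S , b∈S , a<x , b<x , a≢b) with onto a∈S | onto b∈S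
    ... | F.zero  , refl | _             = ℕ.<-irrefl refl a<x
    ... | _              | F.zero  , refl = ℕ.<-irrefl refl b<x
    ... | F.suc i , refl | F.suc j , refl with <-cmp i j
    ...   | tri< i<j _ _ = ¬twoSmallerAfter (F.zero , F.suc i , F.suc j , z<s , s<s i<j , a<x , b<x , a≢b)
    ...   | tri≈ _ refl _ = a≢b refl
    ...   | tri> _ _ j<i = ¬twoSmallerAfter (F.zero , F.suc j , F.suc i , z<s , s<s j<i , b<x , a<x , a≢b ∘ sym)

  Unplaced : ℕ → ℕ → Pred (Fin N) 0ℓ
  Unplaced g t v = toℕ v ≡ g ⊎ t ℕ.< toℕ v

  unplaced? : ∀ g t → Decidable (Unplaced g t)
  unplaced? g t v = (toℕ v ℕ.≟ g) ⊎-dec (t ℕ.<? toℕ v)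

  ∈-Unplaced-0-0 : ∀ v → v ∈ Unplaced 0 0
  ∈-Unplaced-0-0 F.zero    = inj₁ refl
  ∈-Unplaced-0-0 (F.suc _) = inj₂ z<s

  module _ {g t : ℕ} (g≤t : g ≤ t) where

    unplaced-∷-low : ∀ {k x} → toℕ x ≡ g →
                     (λ w → Arranges (Unplaced g t) (x ∷ w)) ≐ Arranges {k} (Unplaced (suc t) (suc t))
    unplaced-∷-low {x = x} x≡g = arranges-∷-≐ (inj₁ x≡g) nothingBelow (remove , insert)
      where
      nothingBelow : ¬ TwoBelow (Unplaced g t) x
      nothingBelow (a , _ , inj₁ a≡g , _ , a<x , _) = ℕ.<-irrefl (trans a≡g (sym x≡g)) a<x
      nothingBelow (a , _ , inj₂ t<a , _ , a<x , _) =
        ℕ.<-asym (ℕ.<-≤-trans a<x (subst (_≤ t) (sym x≡g) g≤t)) t<a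
      remove : Unplaced g t ∖ ｛ x ｝ ⊆ Unplaced (suc t) (suc t)
      remove (inj₁ v≡g , x≢v) = contradiction (toℕ-injective (trans x≡g (sym v≡g))) x≢v
      remove (inj₂ t<v , _)   = [ inj₂ , inj₁ ∘ sym ]′ (ℕ.m≤n⇒m<n∨m≡n t<v)
      insert : Unplaced (suc t) (suc t) ⊆ Unplaced g t ∖ ｛ x ｝
      insert {v} v∈ = inj₂ t<v , λ x≡v → ℕ.<⇒≱ t<v (subst (_≤ t) (trans (sym x≡g) (cong toℕ x≡v)) g≤t)
        where
        t<v : t ℕ.< toℕ v
        t<v = [ (λ v≡1+t → ℕ.≤-reflexive (sym v≡1+t)) , ℕ.<-trans (ℕ.n<1+n t) ]′ v∈

    unplaced-∷-next : ∀ {k x} → toℕ x ≡ suc t →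
                      (λ w → Arranges (Unplaced g t) (x ∷ w)) ≐ Arranges {k} (Unplaced g (suc t))
    unplaced-∷-next {x = x} x≡1+t =
      arranges-∷-≐ (inj₂ (ℕ.≤-reflexive (sym x≡1+t))) onlyOneBelow (remove , insert)
      where
      below-is-g : ∀ {v} → v ∈ Unplaced g t → v F.< x → toℕ v ≡ g
      below-is-g (inj₁ v≡g) _   = v≡g
      below-is-g (inj₂ t<v) v<x = contradiction (subst (toℕ _ ℕ.<_) x≡1+t v<x) (ℕ.<⇒≱ t<v ∘ ℕ.s≤s⁻¹)
      onlyOneBelow : ¬ TwoBelow (Unplaced g t) x
      onlyOneBelow (a , b , a∈ , b∈ , a<x , b<x , a≢b) =
        a≢b (toℕ-injective (trans (below-is-g a∈ a<x) (sym (below-is-g b∈ b<x))))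
      x-above : ∀ {v} → v ∈ Unplaced g (suc t) → x ≢ v
      x-above (inj₁ v≡g)   x≡v = ℕ.<⇒≢ (ℕ.s≤s g≤t) (trans (sym v≡g) (trans (cong toℕ (sym x≡v)) x≡1+t))
      x-above (inj₂ 1+t<v) x≡v = ℕ.<-irrefl (trans (sym x≡1+t) (cong toℕ x≡v)) 1+t<v
      remove : Unplaced g t ∖ ｛ x ｝ ⊆ Unplaced g (suc t)
      remove (inj₁ v≡g , _)   = inj₁ v≡g
      remove (inj₂ t<v , x≢v) = inj₂ (ℕ.≤∧≢⇒< t<v λ 1+t≡v → x≢v (toℕ-injective (trans x≡1+t 1+t≡v)))
      insert : Unplaced g (suc t) ⊆ Unplaced g t ∖ ｛ x ｝
      insert v∈ = [ inj₁ , inj₂ ∘ ℕ.<-trans (ℕ.n<1+n t) ]′ v∈ , x-above v∈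

    unplaced-∷-other : ∀ {k x} {w : Vec (Fin N) k} → toℕ x ≢ g → toℕ x ≢ suc t →
                       ¬ Arranges (Unplaced g t) (x ∷ w)
    unplaced-∷-other x≢g _     (inj₁ x≡g , _) = x≢g x≡g
    unplaced-∷-other {x = x} _ x≢1+t (inj₂ t<x , ¬twoBelow , _) =
      ¬twoBelow (fromℕ< g<N , fromℕ< 1+t<N ,
                 inj₁ (toℕ-fromℕ< g<N) , inj₂ (ℕ.≤-reflexive (sym (toℕ-fromℕ< 1+t<N))) ,
                 subst (ℕ._< toℕ x) (sym (toℕ-fromℕ< g<N)) g<x ,
                 subst (ℕ._< toℕ x) (sym (toℕ-fromℕ< 1+t<N)) 1+t<x ,
                 fromℕ<-≢ g<N 1+t<N (ℕ.<⇒≢ (ℕ.s≤s g≤t)))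
      where
      1+t<x : suc t ℕ.< toℕ x
      1+t<x = ℕ.≤∧≢⇒< t<x (x≢1+t ∘ sym)
      g<x : g ℕ.< toℕ x
      g<x = ℕ.≤-<-trans g≤t t<x
      g<N : g ℕ.< N
      g<N = ℕ.<-trans g<x (toℕ<n x)
      1+t<N : suc t ℕ.< N
      1+t<N = ℕ.<-trans 1+t<x (toℕ<n x)

    unplaced-∷-cases : ∀ {k x} {w : Vec (Fin N) k} → Arranges (Unplaced g t) (x ∷ w) →
                       toℕ x ≡ g × Arranges (Unplaced (suc t) (suc t)) w ⊎
                       toℕ x ≡ suc t × Arranges (Unplaced g (suc t)) w
    unplaced-∷-cases {x = x} arr with toℕ x ℕ.≟ g | toℕ x ℕ.≟ suc t
    ... | yes x≡g | _         = inj₁ (x≡g , proj₁ (unplaced-∷-low x≡g) arr)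
    ... | no _    | yes x≡1+t = inj₂ (x≡1+t , proj₁ (unplaced-∷-next x≡1+t) arr)
    ... | no x≢g  | no x≢1+t  = contradiction arr (unplaced-∷-other x≢g x≢1+t)

  arrangements : ℕ → ℕ → ℕ → ℕ
  arrangements k g t = count (arranges? {k} (unplaced? g t)) (allVecs k)

  module _ {g t : ℕ} (g≤t : g ≤ t) (k : ℕ) {x : Fin N} where

    countAfter-low : toℕ x ≡ g →
                     countAfter (arranges? {suc k} (unplaced? g t)) x ≡ arrangements k (suc t) (suc t)
    countAfter-low x≡g =
      countAfter-≐ (arranges? {suc k} (unplaced? g t)) (arranges? (unplaced? (suc t) (suc t))) x
        (unplaced-∷-low g≤t x≡g)

    countAfter-next : toℕ x ≡ suc t →
                      countAfter (arranges? {suc k} (unplaced? g t)) x ≡ arrangements k g (suc t)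
    countAfter-next x≡1+t =
      countAfter-≐ (arranges? {suc k} (unplaced? g t)) (arranges? (unplaced? g (suc t))) x
        (unplaced-∷-next g≤t x≡1+t)

  arrangements-unplaced : ∀ k {g t} → g ≤ t → suc k + t ≡ N → arrangements (suc k) g t ≡ 2 ^ k
  arrangements-unplaced zero {g} {t} g≤t 1+t≡N = begin
    arrangements 1 g t
      ≡⟨ count-allVecs-point A? ĝ (λ x _ x≢ĝ → unplaced-∷-other g≤t (≢fromℕ<⇒toℕ≢ g<N x≢ĝ) (x≢1+t x)) ⟩
    countAfter A? ĝ
      ≡⟨ countAfter-low g≤t 0 (toℕ-fromℕ< g<N) ⟩
    arrangements 0 (suc t) (suc t)
      ≡⟨ count-singleton (arranges? (unplaced? (suc t) (suc t))) nothing-unplaced ⟩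
    1 ∎
    where
    open ≡-Reasoning
    A? : Decidable (Arranges {1} (Unplaced g t))
    A? = arranges? (unplaced? g t)
    g<N : g ℕ.< N
    g<N = ℕ.≤-<-trans g≤t (subst (t ℕ.<_) 1+t≡N (ℕ.n<1+n t))
    ĝ : Fin N
    ĝ = fromℕ< g<N
    x≢1+t : (x : Fin N) → toℕ x ≢ suc t
    x≢1+t x x≡1+t = ℕ.<-irrefl (trans x≡1+t 1+t≡N) (toℕ<n x)
    nothing-unplaced : Empty (Unplaced (suc t) (suc t))
    nothing-unplaced v (inj₁ v≡1+t) = x≢1+t v v≡1+t
    nothing-unplaced v (inj₂ 1+t<v) = ℕ.<-asym (subst (ℕ._< toℕ v) 1+t≡N 1+t<v) (toℕ<n v)
  arrangements-unplaced (suc k) {g} {t} g≤t 2+k+t≡N = begin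
    arrangements (2 + k) g t
      ≡⟨ count-allVecs-two-points A? ĝ 1+t̂ (fromℕ<-≢ g<N 1+t<N (ℕ.<⇒≢ (s≤s g≤t)))
           (λ x _ x≢ĝ x≢1+t̂ →
              unplaced-∷-other g≤t (≢fromℕ<⇒toℕ≢ g<N x≢ĝ) (≢fromℕ<⇒toℕ≢ 1+t<N x≢1+t̂)) ⟩
    countAfter A? ĝ + countAfter A? 1+t̂
      ≡⟨ cong₂ _+_ (countAfter-low g≤t (suc k) (toℕ-fromℕ< g<N))
                   (countAfter-next g≤t (suc k) (toℕ-fromℕ< 1+t<N)) ⟩
    arrangements (suc k) (suc t) (suc t) + arrangements (suc k) g (suc t)
      ≡⟨ cong₂ _+_ (arrangements-unplaced k ℕ.≤-refl 1+k+1+t≡N)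
                   (arrangements-unplaced k (ℕ.m≤n⇒m≤1+n g≤t) 1+k+1+t≡N) ⟩
    2 ^ k + 2 ^ k
      ≡⟨ cong (2 ^ k +_) (sym (+-identityʳ (2 ^ k))) ⟩
    2 ^ suc k ∎
    where
    open ≡-Reasoning
    A? : Decidable (Arranges {2 + k} (Unplaced g t))
    A? = arranges? (unplaced? g t)
    1+k+1+t≡N : suc k + suc t ≡ N
    1+k+1+t≡N = trans (cong suc (+-suc k t)) 2+k+t≡N
    1+t<N : suc t ℕ.< N
    1+t<N = subst (suc t ℕ.<_) 2+k+t≡N (s≤s (s≤s (ℕ.m≤n+m t k)))
    g<N : g ℕ.< N
    g<N = ℕ.≤-<-trans (ℕ.m≤n⇒m≤1+n g≤t) 1+t<N
    ĝ 1+t̂ : Fin N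
    ĝ   = fromℕ< g<N
    1+t̂ = fromℕ< 1+t<N

injective⇒surjective : ∀ {n} {f : Fin n → Fin n} → Injective _≡_ _≡_ f → ∀ v → ∃ λ i → f i ≡ v
injective⇒surjective {suc n} {f} f-injective v with any? (λ i → f i ≟ v)
... | yes hit  = hit
... | no  miss = contradiction (injective⇒≤ punchOut∘f-injective) ℕ.1+n≰n
  where
  v≢f : ∀ i → v ≢ f i
  v≢f i v≡fᵢ = miss (i , sym v≡fᵢ)
  punchOut∘f-injective : Injective _≡_ _≡_ (λ i → punchOut (v≢f i))
  punchOut∘f-injective p≡p = f-injective (punchOut-injective (v≢f _) (v≢f _) p≡p)

injective₃? : (σ : Vec ℕ 3) → Dec (∀ a b → lookup σ a ≡ lookup σ b → a ≡ b)
injective₃? σ = all? λ a → all? λ b → (lookup σ a ℕ.≟ lookup σ b) →-dec (a ≟ b)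

sameOrder₃-forward : ∀ {N} {σ : Vec ℕ 3} {τ : Vec (Fin N) 3} →
                     (∀ a b → lookup σ a ≡ lookup σ b → a ≡ b) →
                     (∀ a b → lookup σ a ℕ.< lookup σ b → lookup τ a F.< lookup τ b) → SameOrder₃ σ τ
sameOrder₃-forward {σ = σ} {τ} σ-injective forward a b = forward a b , backward
  where
  backward : lookup τ a F.< lookup τ b → lookup σ a ℕ.< lookup σ b
  backward τₐ<τᵦ with ℕ.<-cmp (lookup σ a) (lookup σ b)
  ... | tri< σₐ<σᵦ _ _ = σₐ<σᵦ
  ... | tri≈ _ σₐ≡σᵦ _ =
    contradiction (subst (λ c → lookup τ a F.< lookup τ c) (sym (σ-injective a b σₐ≡σᵦ)) τₐ<τᵦ) (ℕ.<-irrefl refl)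
  ... | tri> _ _ σᵦ<σₐ = contradiction (forward b a σᵦ<σₐ) (ℕ.<-asym τₐ<τᵦ)

-- The auxiliary `forward` functions are phrased with _<ᵇ_ so that the pairs of pattern
-- positions that are out of order are refuted by evaluation.
module _ {N : ℕ} {p q r : Fin N} where

  sameOrder₃-312 : q F.< r → r F.< p → SameOrder₃ (3 ∷ 1 ∷ 2 ∷ []) (p ∷ q ∷ r ∷ [])
  sameOrder₃-312 q<r r<p =
    sameOrder₃-forward {σ = 3 ∷ 1 ∷ 2 ∷ []} {p ∷ q ∷ r ∷ []}
      (toWitness {a? = injective₃? (3 ∷ 1 ∷ 2 ∷ [])} _) (λ a b → forward a b ∘ ℕ.<⇒<ᵇ)
    where
    forward : ∀ a b → T (lookup (3 ∷ 1 ∷ 2 ∷ []) a ℕ.<ᵇ lookup (3 ∷ 1 ∷ 2 ∷ []) b) →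
              lookup (p ∷ q ∷ r ∷ []) a F.< lookup (p ∷ q ∷ r ∷ []) b
    forward 1F 0F _ = ℕ.<-trans q<r r<p
    forward 2F 0F _ = r<p
    forward 1F 2F _ = q<r
    forward 0F 0F ()
    forward 0F 1F ()
    forward 0F 2F ()
    forward 1F 1F ()
    forward 2F 1F ()
    forward 2F 2F ()

  sameOrder₃-321 : r F.< q → q F.< p → SameOrder₃ (3 ∷ 2 ∷ 1 ∷ []) (p ∷ q ∷ r ∷ [])
  sameOrder₃-321 r<q q<p =
    sameOrder₃-forward {σ = 3 ∷ 2 ∷ 1 ∷ []} {p ∷ q ∷ r ∷ []}
      (toWitness {a? = injective₃? (3 ∷ 2 ∷ 1 ∷ [])} _) (λ a b → forward a b ∘ ℕ.<⇒<ᵇ)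
    where
    forward : ∀ a b → T (lookup (3 ∷ 2 ∷ 1 ∷ []) a ℕ.<ᵇ lookup (3 ∷ 2 ∷ 1 ∷ []) b) →
              lookup (p ∷ q ∷ r ∷ []) a F.< lookup (p ∷ q ∷ r ∷ []) b
    forward 1F 0F _ = q<p
    forward 2F 0F _ = ℕ.<-trans r<q q<p
    forward 2F 1F _ = r<q
    forward 0F 0F ()
    forward 0F 1F ()
    forward 0F 2F ()
    forward 1F 1F ()
    forward 1F 2F ()
    forward 2F 2F ()

module _ {n : ℕ} (π : Vec (Fin n) n) where

  contains312⇒twoSmallerAfter : Contains₃ (3 ∷ 1 ∷ 2 ∷ []) π → TwoSmallerAfter π
  contains312⇒twoSmallerAfter (i , j , l , i<j , j<l , same) =
    i , j , l , i<j , j<l , proj₁ (same 1F 0F) (s<s z<s) , proj₁ (same 2F 0F) (s<s (s<s z<s)) ,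
    <⇒≢ (proj₁ (same 1F 2F) (s<s z<s))

  contains321⇒twoSmallerAfter : Contains₃ (3 ∷ 2 ∷ 1 ∷ []) π → TwoSmallerAfter π
  contains321⇒twoSmallerAfter (i , j , l , i<j , j<l , same) =
    i , j , l , i<j , j<l , proj₁ (same 1F 0F) (s<s (s<s z<s)) , proj₁ (same 2F 0F) (s<s z<s) ,
    <⇒≢ (proj₁ (same 2F 1F) (s<s z<s)) ∘ sym

  twoSmallerAfter⇒contains : TwoSmallerAfter π →
                             Contains₃ (3 ∷ 1 ∷ 2 ∷ []) π ⊎ Contains₃ (3 ∷ 2 ∷ 1 ∷ []) π
  twoSmallerAfter⇒contains (i , j , l , i<j , j<l , πⱼ<πᵢ , πₗ<πᵢ , πⱼ≢πₗ)
    with <-cmp (lookup π j) (lookup π l)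
  ... | tri< πⱼ<πₗ _ _ = inj₁ (i , j , l , i<j , j<l , sameOrder₃-312 πⱼ<πₗ πₗ<πᵢ)
  ... | tri≈ _ πⱼ≡πₗ _ = contradiction πⱼ≡πₗ πⱼ≢πₗ
  ... | tri> _ _ πₗ<πⱼ = inj₂ (i , j , l , i<j , j<l , sameOrder₃-321 πₗ<πⱼ πⱼ<πᵢ)

module _ {m : ℕ} {x y z : Fin (3 + m)} {w : Vec (Fin (3 + m)) m} where

  desarrangement⇒descent : x ≢ y → IsDesarrangement (x ∷ y ∷ z ∷ w) → y F.< x
  desarrangement⇒descent _ (F.zero , _ , 2∣1 , _) = contradiction (∣1⇒≡1 2∣1) λ ()
  desarrangement⇒descent x≢y (F.suc _ , _ , _ , noEarlierAscent) with <-cmp x y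
  ... | tri< x<y _ _ = contradiction (inj₂ (1F , refl , x<y)) (noEarlierAscent 0F z<s)
  ... | tri≈ _ x≡y _ = contradiction x≡y x≢y
  ... | tri> _ _ y<x = y<x

  descent⇒desarrangement : y F.< x → y F.< z → IsDesarrangement (x ∷ y ∷ z ∷ w)
  descent⇒desarrangement y<x y<z = 1F , inj₂ (2F , refl , y<z) , ∣-refl , noEarlierAscent
    where
    noEarlierAscent : ∀ q → toℕ q ℕ.< 1 → ¬ Ascent (x ∷ y ∷ z ∷ w) q
    noEarlierAscent 0F _ (inj₁ ())
    noEarlierAscent 0F _ (inj₂ (1F , _ , x<y)) = ℕ.<-asym x<y y<x
    noEarlierAscent 0F _ (inj₂ (0F , () , _))
    noEarlierAscent 0F _ (inj₂ (F.suc (F.suc _) , () , _))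
    noEarlierAscent (F.suc _) (s<s ())

  private
    π : Vec (Fin (3 + m)) (3 + m)
    π = x ∷ y ∷ z ∷ w

  counted⇔arranges-descent : Counted π ⇔ (Arranges (Unplaced 0 0) π × y F.< x)
  counted⇔arranges-descent = mk⇔ to from
    where
    to : Counted π → Arranges (Unplaced 0 0) π × y F.< x
    to (perm , desarrangement , avoids312 , avoids321) =
      arranges-intro π (perm _ _) (∈-Unplaced-0-0 ∘ lookup π)
        (λ {v} _ → injective⇒surjective (perm _ _) v)
        ([ avoids312 , avoids321 ]′ ∘ twoSmallerAfter⇒contains π) ,
      desarrangement⇒descent (λ x≡y → contradiction (perm 0F 1F x≡y) λ ()) desarrangement
    from : Arranges (Unplaced 0 0) π × y F.< x → Counted π
    from (arr , y<x) =
      (λ i j → arranges-injective π arr) , descent⇒desarrangement y<x y<z ,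
      ¬twoSmallerAfter ∘ contains312⇒twoSmallerAfter π , ¬twoSmallerAfter ∘ contains321⇒twoSmallerAfter π
      where
      ¬twoSmallerAfter : ¬ TwoSmallerAfter π
      ¬twoSmallerAfter = arranges⇒¬twoSmallerAfter π arr
      y<z : y F.< z
      y<z with <-cmp y z
      ... | tri< y<z _ _ = y<z
      ... | tri≈ _ y≡z _ = contradiction (arranges-injective π arr {1F} {2F} y≡z) λ ()
      ... | tri> _ _ z<y =
        contradiction (0F , 1F , 2F , z<s , s<s z<s , y<x , ℕ.<-trans z<y y<x , <⇒≢ z<y ∘ sym) ¬twoSmallerAfter

module _ {m : ℕ} {x y : Fin (3 + m)} {w : Vec (Fin (3 + m)) (suc m)} where

  arranges-descent⇔ : (Arranges (Unplaced 0 0) (x ∷ y ∷ w) × y F.< x) ⇔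
                      (x ≡ 1F × y ≡ 0F × Arranges (Unplaced 2 2) w)
  arranges-descent⇔ = mk⇔ to from
    where
    to : Arranges (Unplaced 0 0) (x ∷ y ∷ w) × y F.< x → x ≡ 1F × y ≡ 0F × Arranges (Unplaced 2 2) w
    to (arr , y<x) with unplaced-∷-cases z≤n arr
    ... | inj₁ (x≡0 , _) = contradiction (subst (toℕ y ℕ.<_) x≡0 y<x) λ ()
    ... | inj₂ (x≡1 , arr′) with unplaced-∷-cases z≤n arr′
    ...   | inj₁ (y≡0 , rest) = toℕ-injective x≡1 , toℕ-injective y≡0 , rest
    ...   | inj₂ (y≡2 , _)    = contradiction (subst₂ ℕ._<_ y≡2 x≡1 y<x) λ { (s<s ()) }
    from : x ≡ 1F × y ≡ 0F × Arranges (Unplaced 2 2) w → Arranges (Unplaced 0 0) (x ∷ y ∷ w) × y F.< x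
    from (refl , refl , rest) =
      proj₂ (unplaced-∷-next z≤n refl) (proj₂ (unplaced-∷-low z≤n refl) rest) , z<s

counted⇔1-0-arranges : ∀ {m} {x y : Fin (3 + m)} {w : Vec (Fin (3 + m)) (suc m)} →
           Counted (x ∷ y ∷ w) ⇔ (x ≡ 1F × y ≡ 0F × Arranges (Unplaced 2 2) w)
counted⇔1-0-arranges {w = _ ∷ _} = ⇔.trans counted⇔arranges-descent arranges-descent⇔

theorem3p16 : (n : ℕ) → 3 ≤ n → d-312-321 n ≡ 2 ^ (n ∸ 3)
theorem3p16 (suc (suc (suc m))) (s≤s (s≤s (s≤s z≤n))) = begin
  d-312-321 (3 + m)
    ≡⟨ count-allVecs-point (counted? {3 + m}) 1F
         (λ { x (y ∷ w) x≢1 → x≢1 ∘ proj₁ ∘ to counted⇔1-0-arranges }) ⟩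
  countAfter (counted? {3 + m}) 1F
    ≡⟨ count-allVecs-point counted-1∷? 0F (λ y w y≢0 → y≢0 ∘ proj₁ ∘ proj₂ ∘ to counted⇔1-0-arranges) ⟩
  countAfter counted-1∷? 0F
    ≡⟨ countAfter-≐ counted-1∷? (arranges? (unplaced? 2 2)) 0F
         (proj₂ ∘ proj₂ ∘ to counted⇔1-0-arranges , λ arr → from counted⇔1-0-arranges (refl , refl , arr)) ⟩
  arrangements {3 + m} (suc m) 2 2
    ≡⟨ arrangements-unplaced m ℕ.≤-refl (cong suc (+-comm m 2)) ⟩
  2 ^ m ∎
  where
  open ≡-Reasoning
  open Equivalence
  counted-1∷? : Decidable (λ (v : Vec (Fin (3 + m)) (2 + m)) → Counted (1F ∷ v))
  counted-1∷? v = counted? (1F ∷ v)
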